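{- Let $S$ be a sorting sequence of length $p$ with $r>1$ distinct values, and let $k\ge1$. If there exists a configuration of $f$ fake coins in $p$ piles of $k$ coins consistent with $S$ (i.e. a general solution for $S$ with $f$ fake coins satisfying the height bound for $k$), then there exists a general solution for $S$ with $f$ fake coins and a general solution for the reverse sequence $S'$ with $pk-f$ fake coins.
   Context: A sorting sequence of length $p$ is a non-decreasing sequence of $p$ non-negative integers beginning with $0$ in which each entry equals the previous one or exceeds it by $1$ (it records the outcome of sorting $p$ piles of $k$ coins by weight, fake coins being lighter). If its distinct entries are $0,\dots,r-1$, let $p_i\ge1$ be the number of entries equal to $i-1$. A general solution with $f$ fake coins is an integer tuple $(f_1,\dots,f_r)$ with $0\le f_1<\dots<f_r$ and $\sum_i p_if_i=f$; it satisfies the height bound for $k$ if $f_r\le k$. The reverse sequence $S'$ is the sorting sequence of length $p$ with $r$ distinct values in which the number of entries equal to $i-1$ is $p_{r-i+1}$. -}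

module Defs where

open import Data.Nat using (ℕ; zero; suc; _+_; _*_; _≤_; _<_)
open import Data.Nat.Properties using (_≟_)
open import Data.Fin as Fin using (Fin; toℕ; fromℕ)
open import Data.List using (List; []; _∷_; length; filter; tabulate)
open import Data.Nat.ListAction using (sum)
open import Data.List.Membership.Propositional using (_∈_)
open import Data.Product using (_×_)
open import Data.Sum using (_⊎_)
open import Data.Unit using (⊤)
open import Relation.Binary.PropositionalEquality using (_≡_)
open import Function.Bundles using (_⇔_)

data Steps : List ℕ → Set where
  steps-[]  : Steps []
  steps-one : ∀ x → Steps (x ∷ [])
  steps-∷   : ∀ x y ys → (y ≡ x ⊎ y ≡ suc x) → Steps (y ∷ ys) → Steps (x ∷ y ∷ ys)

data SortingSeq : List ℕ → Set where
  sorting : ∀ xs → Steps (0 ∷ xs) → SortingSeq (0 ∷ xs)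

HasDistinctValues : List ℕ → ℕ → Set
HasDistinctValues S r = ∀ x → (x ∈ S) ⇔ (x < r)

count : ℕ → List ℕ → ℕ
count v S = length (filter (_≟ v) S)

-- p_i (paper, 1-indexed) = blockSize S i (0-indexed i ↦ count of value i)
blockSize : ∀ {r} → List ℕ → Fin r → ℕ
blockSize S i = count (toℕ i) S

record GeneralSolution (S : List ℕ) (r : ℕ) (f : ℕ) : Set where
  field
    fs         : Fin r → ℕ
    increasing : ∀ (i j : Fin r) → i Fin.< j → fs i < fs j
    total      : sum (tabulate (λ (i : Fin r) → blockSize S i * fs i)) ≡ f

HeightBound : ∀ {r} → ℕ → (Fin r → ℕ) → Set
HeightBound {zero}  k fs = ⊤
HeightBound {suc n} k fs = fs (fromℕ n) ≤ k

-- S' is the reverse sequence of S (S of length p with r distinct values):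
-- a sorting sequence of length p with r distinct values, whose number of
-- entries equal to i-1 is p_{r-i+1}  (0-indexed: count i S' = count (r-1-i) S).
IsReverseOf : List ℕ → List ℕ → ℕ → Set
IsReverseOf S' S r =
  SortingSeq S' × length S' ≡ length S × HasDistinctValues S' r ×
  (∀ (i : Fin r) → blockSize S' i ≡ blockSize S (Fin.opposite i))

-- Complementing every pile turns a solution upside down: since the f_i increase and
-- f_r ≤ k, all f_i lie in [0, k], so f'_i = k − f_{r+1−i} is again strictly increasing,
-- and it solves the reverse sequence because Σ_i p_{r+1−i} (k − f_{r+1−i})
-- = k Σ_i p_i − Σ_i p_i f_i = pk − f, the block sizes p_i summing to p.
module Submission where

open import Defs
open import Data.Nat using (ℕ; zero; suc; _+_; _*_; _∸_; _≤_; _<_; s≤s; s≤s⁻¹)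
open import Data.Nat.Properties
open import Data.Bool using (true; false)
open import Data.List using (List; []; _∷_; [_]; length; tabulate)
open import Data.Nat.ListAction using (sum)
open import Data.List.Membership.Propositional using (_∈_)
open import Data.List.Relation.Unary.Any using (here; there)
open import Data.Fin as Fin using (Fin; toℕ; fromℕ; opposite)
import Data.Fin.Properties as Fin
import Data.Fin.Permutation as Perm
open import Data.Product using (Σ; _×_; _,_)
open import Data.Sum using (inj₁; inj₂)
open import Function.Base using (_∘_)
open import Function.Bundles using (Equivalence)
open import Relation.Nullary.Decidable using (does)
open import Relation.Binary.PropositionalEquality using (_≡_; refl; sym; trans; cong; cong₂; module ≡-Reasoning)
open import Algebra.Properties.Semiring.Sum +-*-semiring
  using (sum-syntax; sum-cong-≗; ∑-distrib-+; ∑-permute; *-distribʳ-sum; sum-replicate-zero)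

sum-tabulate : ∀ {r} (g : Fin r → ℕ) → sum (tabulate g) ≡ ∑[ i < r ] g i
sum-tabulate {zero}  g = refl
sum-tabulate {suc r} g = cong (g Fin.zero +_) (sum-tabulate (g ∘ Fin.suc))

count-∷ : ∀ v x S → count v (x ∷ S) ≡ count v [ x ] + count v S
count-∷ v x S with does (x ≟ v)
... | true  = refl
... | false = refl

count-suc-[suc] : ∀ v x → count (suc v) [ suc x ] ≡ count v [ x ]
count-suc-[suc] v x with does (x ≟ v)
... | true  = refl
... | false = refl

∑-count-singleton : ∀ {r} x → x < r → ∑[ i < r ] count (toℕ i) [ x ] ≡ 1
∑-count-singleton {suc r} zero    _         = cong suc (sum-replicate-zero r)
∑-count-singleton {suc r} (suc x) (s≤s x<r) =
  trans (sum-cong-≗ {r} (λ i → count-suc-[suc] (toℕ i) x)) (∑-count-singleton x x<r)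

∑-count≡length : ∀ r S → (∀ x → x ∈ S → x < r) → ∑[ i < r ] count (toℕ i) S ≡ length S
∑-count≡length r [] _ = sum-replicate-zero r
∑-count≡length r (x ∷ S) S<r = begin
  ∑[ i < r ] count (toℕ i) (x ∷ S)
    ≡⟨ sum-cong-≗ {r} (λ i → count-∷ (toℕ i) x S) ⟩
  ∑[ i < r ] (count (toℕ i) [ x ] + count (toℕ i) S)
    ≡⟨ ∑-distrib-+ {r} (λ i → count (toℕ i) [ x ]) (λ i → count (toℕ i) S) ⟩
  ∑[ i < r ] count (toℕ i) [ x ] + ∑[ i < r ] count (toℕ i) S
    ≡⟨ cong₂ _+_ (∑-count-singleton x (S<r x (here refl))) (∑-count≡length r S (λ y → S<r y ∘ there)) ⟩
  suc (length S) ∎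
  where open ≡-Reasoning

∑-blockSize≡length : ∀ {S r} → HasDistinctValues S r → ∑[ i < r ] blockSize S i ≡ length S
∑-blockSize≡length {S} {r} distinct = ∑-count≡length r S (λ x → Equivalence.to (distinct x))

increasing⇒≤last : ∀ {n} (fs : Fin (suc n) → ℕ) → (∀ i j → i Fin.< j → fs i < fs j) →
                   ∀ j → fs j ≤ fs (fromℕ n)
increasing⇒≤last {n} fs increasing j with m≤n⇒m<n∨m≡n (Fin.≤fromℕ j)
... | inj₁ j<last = <⇒≤ (increasing j (fromℕ n) j<last)
... | inj₂ j≡last = ≤-reflexive (cong fs (Fin.toℕ-injective j≡last))

opposite-reverses-< : ∀ {n} {i j : Fin n} → i Fin.< j → opposite j Fin.< opposite i
opposite-reverses-< {suc n} {i} {j} i<j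
  rewrite Fin.opposite-prop i | Fin.opposite-prop j = ∸-monoʳ-< i<j (s≤s⁻¹ (Fin.toℕ<n j))

*-complement-+ : ∀ m {a k} → a ≤ k → m * (k ∸ a) + m * a ≡ m * k
*-complement-+ m {a} {k} a≤k = begin
  m * (k ∸ a) + m * a   ≡⟨ cong (_+ m * a) (*-distribˡ-∸ m k a) ⟩
  m * k ∸ m * a + m * a ≡⟨ m∸n+n≡m (*-monoʳ-≤ m a≤k) ⟩
  m * k                 ∎
  where open ≡-Reasoning

module _ {S r f} (g : GeneralSolution S r f) (distinct : HasDistinctValues S r)
         {k} (fs≤k : ∀ i → GeneralSolution.fs g i ≤ k) where
  open GeneralSolution g

  complement-total : ∑[ i < r ] (blockSize S i * (k ∸ fs i)) + f ≡ length S * k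
  complement-total = begin
    ∑[ i < r ] (blockSize S i * (k ∸ fs i)) + f
      ≡⟨ cong (_ +_) (trans (sym total) (sum-tabulate {r} _)) ⟩
    ∑[ i < r ] (blockSize S i * (k ∸ fs i)) + ∑[ i < r ] (blockSize S i * fs i)
      ≡⟨ ∑-distrib-+ {r} _ _ ⟨
    ∑[ i < r ] (blockSize S i * (k ∸ fs i) + blockSize S i * fs i)
      ≡⟨ sum-cong-≗ {r} (λ i → *-complement-+ (blockSize S i) (fs≤k i)) ⟩
    ∑[ i < r ] (blockSize S i * k)
      ≡⟨ *-distribʳ-sum k (blockSize {r} S) ⟨
    (∑[ i < r ] blockSize S i) * k
      ≡⟨ cong (_* k) (∑-blockSize≡length distinct) ⟩
    length S * k ∎
    where open ≡-Reasoning

  reverseSolution : ∀ {S'} → (∀ i → blockSize S' i ≡ blockSize S (opposite i)) →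
                    GeneralSolution S' r (length S * k ∸ f)
  reverseSolution {S'} reversed = record
    { fs         = λ i → k ∸ fs (opposite i)
    ; increasing = λ i j i<j →
        ∸-monoʳ-< (increasing _ _ (opposite-reverses-< i<j)) (fs≤k (opposite i))
    ; total      = begin
        sum (tabulate (λ i → blockSize S' i * (k ∸ fs (opposite i))))
          ≡⟨ sum-tabulate {r} _ ⟩
        ∑[ i < r ] (blockSize S' i * (k ∸ fs (opposite i)))
          ≡⟨ sum-cong-≗ {r} (λ i → cong (_* (k ∸ fs (opposite i))) (reversed i)) ⟩
        ∑[ i < r ] (blockSize S (opposite i) * (k ∸ fs (opposite i)))
          ≡⟨ ∑-permute (λ i → blockSize S i * (k ∸ fs i)) Perm.reverse ⟨
        ∑[ i < r ] (blockSize S i * (k ∸ fs i))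
          ≡⟨ m+n∸n≡m _ f ⟨
        ∑[ i < r ] (blockSize S i * (k ∸ fs i)) + f ∸ f
          ≡⟨ cong (_∸ f) complement-total ⟩
        length S * k ∸ f ∎
    }
    where open ≡-Reasoning

mainTheorem7 : (S : List ℕ) (p r k f : ℕ) →
    SortingSeq S → length S ≡ p → HasDistinctValues S r → 1 < r → 1 ≤ k →
    Σ (GeneralSolution S r f) (λ g → HeightBound k (GeneralSolution.fs g)) →
    GeneralSolution S r f ×
      ((S' : List ℕ) → IsReverseOf S' S r → GeneralSolution S' r (p * k ∸ f))
mainTheorem7 S _ (suc n) k f _ refl distinct _ _ (g , top≤k) =
  g , λ S' (_ , _ , _ , reversed) → reverseSolution g distinct fs≤k reversed
  where
  open GeneralSolution g
  fs≤k : ∀ i → fs i ≤ k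
  fs≤k i = ≤-trans (increasing⇒≤last fs increasing i) top≤k
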